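{- Let $n$ be a positive integer, $B$ an $\overline{n}^{\top}$-free join-semilattice with least element $\mathbf 0$, $\gamma$ an ordinal, and $\varrho:[\gamma]^2\to B$ transitive and subadditive, with the convention $\varrho(\alpha,\alpha)=\mathbf 0$. Then $(\gamma\times B,\trianglelefteq_\varrho)$ is an $\overline{(n+1)}^{\top}$-free join-semilattice, where $(\alpha,p)\trianglelefteq_\varrho(\beta,q)$ iff $\alpha\le\beta$ and $p\vee\varrho(\alpha,\beta)\le q$.
   Context: For $\alpha<\beta<\gamma$, $\varrho(\alpha,\beta)$ denotes $\varrho(\{\alpha,\beta\})$. $\varrho$ is transitive if $\varrho(\alpha,\delta)\le\varrho(\alpha,\beta)\vee\varrho(\beta,\delta)$ for all $\alpha<\beta<\delta<\gamma$, and subadditive if $\varrho(\alpha,\beta)\le\varrho(\alpha,\delta)\vee\varrho(\beta,\delta)$ for all $\alpha<\beta<\delta<\gamma$. For $k\in\omega$, $\overline{k}^{\top}$ is the join-semilattice on $\{0,\dots,k-1\}\sqcup\{\mathbf 1\}$ with $x\vee y=\mathbf 1$ for all distinct $x,y$; a join-semilattice is $\overline{k}^{\top}$-free if it has no join-subsemilattice isomorphic to $\overline{k}^{\top}$. -}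

module Defs where

open import Level using (Level; _⊔_) renaming (suc to lsuc)
open import Data.Nat using (ℕ)
open import Data.Fin using (Fin; _≟_)
open import Data.Maybe using (Maybe; just; nothing)
open import Data.Product using (Σ; _×_)
open import Data.Sum using (_⊎_)
open import Function.Definitions using (Injective)
open import Relation.Nullary using (¬_; yes; no)
open import Relation.Binary.Core using (Rel)
open import Relation.Binary.Structures using (IsStrictTotalOrder)
open import Relation.Binary.PropositionalEquality using (_≡_)
open import Induction.WellFounded using (WellFounded)
open import Relation.Binary.Lattice.Bundles using (BoundedJoinSemilattice)

-- The join-semilattice  k̄^⊤ : carrier {0,…,k-1} ⊔ {𝟏},
-- represented as Maybe (Fin k) with nothing = 𝟏;  x ∨ y = 𝟏 for x ≠ y,
-- x ∨ x = x.

kTopJoin : ∀ {k} → Maybe (Fin k) → Maybe (Fin k) → Maybe (Fin k)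
kTopJoin (just i) (just j) with i ≟ j
... | yes _ = just i
... | no  _ = nothing
kTopJoin (just _) nothing  = nothing
kTopJoin nothing  _        = nothing

-- A join-subsemilattice of (A, ≈, ∨) isomorphic to k̄^⊤ is the image of an
-- injective join-preserving map k̄^⊤ → A.  "k̄^⊤-free" = there is none.
KTopFree : ∀ {a ℓ} (k : ℕ) {A : Set a} (_≈_ : Rel A ℓ) (_∨_ : A → A → A) → Set (a ⊔ ℓ)
KTopFree k {A} _≈_ _∨_ =
  ¬ Σ (Maybe (Fin k) → A) (λ f →
      Injective _≡_ _≈_ f × (∀ x y → f (kTopJoin x y) ≈ (f x ∨ f y)))

record Ordinal (a ℓ : Level) : Set (lsuc (a ⊔ ℓ)) where
  field
    Carrier            : Set a
    _<_                : Rel Carrier ℓ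
    isStrictTotalOrder : IsStrictTotalOrder _≡_ _<_
    wellFounded        : WellFounded _<_

-- ϱ : [γ]² → B is given as a function ρ α β, read only for α < β.
-- The ordering ⊴_ϱ on γ × B, with the convention ϱ(α,α) = 𝟎.

module RhoOrder {a ℓ c ℓ₁ ℓ₂} (γ : Ordinal a ℓ) (B : BoundedJoinSemilattice c ℓ₁ ℓ₂)
                (ρ : Ordinal.Carrier γ → Ordinal.Carrier γ → BoundedJoinSemilattice.Carrier B) where
  open Ordinal γ renaming (Carrier to Γ)
  open BoundedJoinSemilattice B renaming (Carrier to 𝔹)

  RhoTransitive : Set (a ⊔ ℓ ⊔ ℓ₂)
  RhoTransitive = ∀ {α β δ} → α < β → β < δ → ρ α δ ≤ (ρ α β ∨ ρ β δ)

  RhoSubadditive : Set (a ⊔ ℓ ⊔ ℓ₂)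
  RhoSubadditive = ∀ {α β δ} → α < β → β < δ → ρ α β ≤ (ρ α δ ∨ ρ β δ)

  _≋_ : Rel (Γ × 𝔹) (a ⊔ ℓ₁)
  (α Data.Product., p) ≋ (β Data.Product., q) = α ≡ β × p ≈ q

  _⊴_ : Rel (Γ × 𝔹) (a ⊔ ℓ ⊔ ℓ₂)
  (α Data.Product., p) ⊴ (β Data.Product., q) =
    (α ≡ β × (p ∨ ⊥) ≤ q) ⊎ (α < β × (p ∨ ρ α β) ≤ q)

{-# OPTIONS --safe #-}
-- The join of (α , p) and (β , q) with α < β is (β , (p ∨ ρ α β) ∨ q): transitivity of ρ makes ⊴
-- transitive and subadditivity makes this upper bound least. The join thus lies over one of the two
-- ordinals, and over a single ordinal it is the join of B. In a copy of \overline{n+1}^⊤ any two distinct atoms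
-- join to the top, so one of them lies over the ordinal of the top; hence all atoms but at most one do,
-- and dropping that one leaves a copy of \overline{n}^⊤ in a single fibre, i.e. in B.
module Submission where

open import Defs
open import Data.Nat using (ℕ; suc; _≤_)
open import Data.Product using (Σ; _×_)
open import Relation.Binary.Lattice.Bundles using (BoundedJoinSemilattice)
open import Relation.Binary.Lattice.Structures using (IsJoinSemilattice)

open import Algebra.Core using (Op₂)
open import Data.Fin using (Fin; zero; punchIn) renaming (_≟_ to _≟ᶠ_)
open import Data.Fin.Properties using (all?; ¬∀⟶∃¬; punchIn-injective; punchInᵢ≢i)
open import Data.Maybe using (Maybe; just; nothing; map)
open import Data.Maybe.Properties using (map-injective)
open import Data.Product using (_,_; proj₁; proj₂; ∃-syntax)
open import Data.Product.Relation.Binary.Pointwise.NonDependent using (Pointwise; ×-isEquivalence)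
open import Data.Sum using (_⊎_; inj₁; inj₂; fromInj₁) renaming (map to map-⊎)
open import Function using (_∘_)
open import Function.Definitions using (Injective)
open import Relation.Binary.Bundles using (Setoid; Poset)
open import Relation.Binary.Definitions using (DecidableEquality; Transitive; Antisymmetric; tri<; tri≈; tri>)
open import Relation.Binary.Lattice.Definitions using (Supremum)
open import Relation.Binary.PropositionalEquality as ≡ using (_≡_; _≢_; refl; cong)
open import Relation.Binary.Structures using (IsPartialOrder; IsStrictTotalOrder)
open import Relation.Nullary using (yes; no; contradiction)
open import Relation.Unary using (Pred; Decidable)

all-but-one : ∀ {n p} {P : Pred (Fin (suc n)) p} → Decidable P →
              (∀ i j → i ≢ j → P i ⊎ P j) → ∃[ k ] ∀ i → i ≢ k → P i
all-but-one {n} {P = P} P? P-pairwise with all? P?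
... | yes ∀P = zero , λ i _ → ∀P i
... | no ¬∀P with ¬∀⟶∃¬ (suc n) P P? ¬∀P
...   | k , ¬Pk = k , λ i i≢k → fromInj₁ (λ Pk → contradiction Pk ¬Pk) (P-pairwise i k i≢k)

kTopJoin-≢ : ∀ {k} {i j : Fin k} → i ≢ j → kTopJoin (just i) (just j) ≡ nothing
kTopJoin-≢ {i = i} {j} i≢j with i ≟ᶠ j
... | yes i≡j = contradiction i≡j i≢j
... | no _    = refl

kTopJoin-idem : ∀ {k} (i : Fin k) → kTopJoin (just i) (just i) ≡ just i
kTopJoin-idem i with i ≟ᶠ i
... | yes _   = refl
... | no i≢i = contradiction refl i≢i

map-kTopJoin : ∀ {m n} {f : Fin m → Fin n} → Injective _≡_ _≡_ f →
               ∀ x y → map f (kTopJoin x y) ≡ kTopJoin (map f x) (map f y)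
map-kTopJoin {f = f} f-injective (just i) (just j) with i ≟ᶠ j
... | yes refl = ≡.sym (kTopJoin-idem (f i))
... | no i≢j   = ≡.sym (kTopJoin-≢ (i≢j ∘ f-injective))
map-kTopJoin f-injective (just i) nothing = refl
map-kTopJoin f-injective nothing  y       = refl

module _ {a c ℓ} {Γ : Set a} (_≟_ : DecidableEquality Γ) (S : Setoid c ℓ)
         (_∨_ : Op₂ (Setoid.Carrier S)) (_⊔_ : Op₂ (Γ × Setoid.Carrier S)) where
  open Setoid S using (_≈_) renaming (Carrier to 𝔹)

  kTopFree-suc-fibred :
    (∀ x y → proj₁ (x ⊔ y) ≡ proj₁ x ⊎ proj₁ (x ⊔ y) ≡ proj₁ y) →
    (∀ x y → proj₁ x ≡ proj₁ y → proj₂ (x ⊔ y) ≈ (proj₂ x ∨ proj₂ y)) →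
    ∀ {n} → KTopFree n _≈_ _∨_ → KTopFree (suc n) (Pointwise _≡_ _≈_) _⊔_
  kTopFree-suc-fibred ⊔-selective ⊔-fibrewise B-free (f , f-injective , f-hom) =
    B-free (g , g-injective , g-hom)
    where
    δ : Γ
    δ = proj₁ (f nothing)

    atom-in-top-fibre : ∀ i j → i ≢ j → proj₁ (f (just i)) ≡ δ ⊎ proj₁ (f (just j)) ≡ δ
    atom-in-top-fibre i j i≢j =
      map-⊎ (λ e → ≡.trans (≡.sym e) join-in-top-fibre) (λ e → ≡.trans (≡.sym e) join-in-top-fibre)
            (⊔-selective (f (just i)) (f (just j)))
      where
      open ≡.≡-Reasoning
      join-in-top-fibre : proj₁ (f (just i) ⊔ f (just j)) ≡ δ
      join-in-top-fibre = begin
        proj₁ (f (just i) ⊔ f (just j))         ≡⟨ proj₁ (f-hom (just i) (just j)) ⟨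
        proj₁ (f (kTopJoin (just i) (just j)))  ≡⟨ cong (proj₁ ∘ f) (kTopJoin-≢ i≢j) ⟩
        δ                                       ∎

    outlier : ∃[ k ] ∀ i → i ≢ k → proj₁ (f (just i)) ≡ δ
    outlier = all-but-one (λ i → proj₁ (f (just i)) ≟ δ) atom-in-top-fibre

    k : Fin _
    k = proj₁ outlier

    embed : Maybe (Fin _) → Maybe (Fin _)
    embed = map (punchIn k)

    embed-in-top-fibre : ∀ x → proj₁ (f (embed x)) ≡ δ
    embed-in-top-fibre nothing  = refl
    embed-in-top-fibre (just i) = proj₂ outlier (punchIn k i) (punchInᵢ≢i k i)

    same-fibre : ∀ x y → proj₁ (f (embed x)) ≡ proj₁ (f (embed y))
    same-fibre x y = ≡.trans (embed-in-top-fibre x) (≡.sym (embed-in-top-fibre y))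

    g : Maybe (Fin _) → 𝔹
    g = proj₂ ∘ f ∘ embed

    g-injective : Injective _≡_ _≈_ g
    g-injective {x} {y} gx≈gy =
      map-injective (punchIn-injective k _ _) (f-injective (same-fibre x y , gx≈gy))

    g-hom : ∀ x y → g (kTopJoin x y) ≈ (g x ∨ g y)
    g-hom x y = begin
      g (kTopJoin x y)                          ≡⟨ cong (proj₂ ∘ f) (map-kTopJoin (punchIn-injective k _ _) x y) ⟩
      proj₂ (f (kTopJoin (embed x) (embed y)))  ≈⟨ proj₂ (f-hom (embed x) (embed y)) ⟩
      proj₂ (f (embed x) ⊔ f (embed y))         ≈⟨ ⊔-fibrewise (f (embed x)) (f (embed y)) (same-fibre x y) ⟩
      g x ∨ g y                                 ∎
      where open import Relation.Binary.Reasoning.Setoid S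

module RhoJoin {a ℓ c ℓ₁ ℓ₂} (γ : Ordinal a ℓ) (B : BoundedJoinSemilattice c ℓ₁ ℓ₂)
         (ρ : Ordinal.Carrier γ → Ordinal.Carrier γ → BoundedJoinSemilattice.Carrier B) where
  open Ordinal γ using (_<_; isStrictTotalOrder) renaming (Carrier to Γ)
  open IsStrictTotalOrder isStrictTotalOrder using (compare; irrefl; asym) renaming (trans to <-trans)
  open BoundedJoinSemilattice B
    using (_≈_; _∨_; minimum; x≤x∨y; y≤x∨y; ∨-least; reflexive; antisym; isEquivalence; module Eq; poset)
    renaming (Carrier to 𝔹; _≤_ to _≼_; trans to ≼-trans)
  open RhoOrder γ B ρ using (_≋_; _⊴_; RhoTransitive; RhoSubadditive)
  open import Relation.Binary.Reasoning.PartialOrder poset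

  x∨y≼z⇒x≼z : ∀ {x y z} → x ∨ y ≼ z → x ≼ z
  x∨y≼z⇒x≼z = ≼-trans (x≤x∨y _ _)

  x∨y≼z⇒y≼z : ∀ {x y z} → x ∨ y ≼ z → y ≼ z
  x∨y≼z⇒y≼z = ≼-trans (y≤x∨y _ _)

  ⊴-fibre : ∀ {α p q} → p ≼ q → (α , p) ⊴ (α , q)
  ⊴-fibre {q = q} p≼q = inj₁ (refl , ∨-least p≼q (minimum q))

  ⊴-reflexive : ∀ {x y} → x ≋ y → x ⊴ y
  ⊴-reflexive (refl , p≈q) = ⊴-fibre (reflexive p≈q)

  ⊴-trans : RhoTransitive → Transitive _⊴_
  ⊴-trans ρ-trans (inj₁ (refl , pq)) (inj₁ (refl , qr)) = ⊴-fibre (≼-trans (x∨y≼z⇒x≼z pq) (x∨y≼z⇒x≼z qr))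
  ⊴-trans ρ-trans (inj₁ (refl , pq)) (inj₂ (β<δ , qr)) =
    inj₂ (β<δ , ∨-least (≼-trans (x∨y≼z⇒x≼z pq) (x∨y≼z⇒x≼z qr)) (x∨y≼z⇒y≼z qr))
  ⊴-trans ρ-trans (inj₂ (α<β , pq)) (inj₁ (refl , qr)) = inj₂ (α<β , ≼-trans pq (x∨y≼z⇒x≼z qr))
  ⊴-trans ρ-trans {α , p} {β , q} {δ , r} (inj₂ (α<β , pq)) (inj₂ (β<δ , qr)) =
    inj₂ (<-trans α<β β<δ , ∨-least (≼-trans (x∨y≼z⇒x≼z pq) (x∨y≼z⇒x≼z qr)) (begin
      ρ α δ           ≤⟨ ρ-trans α<β β<δ ⟩
      ρ α β ∨ ρ β δ   ≤⟨ ∨-least (≼-trans (x∨y≼z⇒y≼z pq) (x∨y≼z⇒x≼z qr)) (x∨y≼z⇒y≼z qr) ⟩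
      r               ∎))

  ⊴-antisym : Antisymmetric _≋_ _⊴_
  ⊴-antisym (inj₁ (refl , pq)) (inj₁ (_ , qp))    = refl , antisym (x∨y≼z⇒x≼z pq) (x∨y≼z⇒x≼z qp)
  ⊴-antisym (inj₁ (refl , _))  (inj₂ (α<α , _))   = contradiction α<α (irrefl refl)
  ⊴-antisym (inj₂ (α<α , _))   (inj₁ (refl , _))  = contradiction α<α (irrefl refl)
  ⊴-antisym (inj₂ (α<β , _))   (inj₂ (β<α , _))   = contradiction β<α (asym α<β)

  ⊴-isPartialOrder : RhoTransitive → IsPartialOrder _≋_ _⊴_
  ⊴-isPartialOrder ρ-trans = record
    { isPreorder = record
      { isEquivalence = ×-isEquivalence ≡.isEquivalence isEquivalence
      ; reflexive     = ⊴-reflexive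
      ; trans         = ⊴-trans ρ-trans
      }
    ; antisym = ⊴-antisym
    }

  _⊔<_ : Op₂ (Γ × 𝔹)
  (α , p) ⊔< (β , q) = β , (p ∨ ρ α β) ∨ q

  _⊔_ : Op₂ (Γ × 𝔹)
  (α , p) ⊔ (β , q) with compare α β
  ... | tri< _ _ _ = (α , p) ⊔< (β , q)
  ... | tri≈ _ _ _ = α , p ∨ q
  ... | tri> _ _ _ = (β , q) ⊔< (α , p)

  ⊴-fibre-least : ∀ {α p q} z → (α , p) ⊴ z → (α , q) ⊴ z → (α , p ∨ q) ⊴ z
  ⊴-fibre-least _ (inj₁ (refl , pr)) (inj₁ (_ , qr))    =
    ⊴-fibre (∨-least (x∨y≼z⇒x≼z pr) (x∨y≼z⇒x≼z qr))
  ⊴-fibre-least _ (inj₁ (refl , _))  (inj₂ (α<α , _))   = contradiction α<α (irrefl refl)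
  ⊴-fibre-least _ (inj₂ (α<α , _))   (inj₁ (refl , _))  = contradiction α<α (irrefl refl)
  ⊴-fibre-least _ (inj₂ (α<δ , pr))  (inj₂ (_ , qr))    =
    inj₂ (α<δ , ∨-least (∨-least (x∨y≼z⇒x≼z pr) (x∨y≼z⇒x≼z qr)) (x∨y≼z⇒y≼z pr))

  ⊴-raise : RhoSubadditive → ∀ {α β p q} z → α < β → (α , p) ⊴ z → (β , q) ⊴ z →
            (β , p ∨ ρ α β) ⊴ z
  ⊴-raise ρ-sub _ α<α (inj₁ (refl , _)) (inj₁ (refl , _)) = contradiction α<α (irrefl refl)
  ⊴-raise ρ-sub _ α<β (inj₁ (refl , _)) (inj₂ (β<α , _))  = contradiction β<α (asym α<β)
  ⊴-raise ρ-sub _ α<β (inj₂ (_ , pr))   (inj₁ (refl , _)) = ⊴-fibre pr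
  ⊴-raise ρ-sub {α} {β} (δ , r) α<β (inj₂ (α<δ , pr)) (inj₂ (β<δ , qr)) =
    inj₂ (β<δ , ∨-least (∨-least (x∨y≼z⇒x≼z pr) (begin
      ρ α β           ≤⟨ ρ-sub α<β β<δ ⟩
      ρ α δ ∨ ρ β δ   ≤⟨ ∨-least (x∨y≼z⇒y≼z pr) (x∨y≼z⇒y≼z qr) ⟩
      r               ∎)) (x∨y≼z⇒y≼z qr))

  ⊔<-supremum : RhoSubadditive → ∀ {α β} p q → α < β →
                let x = (α , p); y = (β , q) in
                x ⊴ (x ⊔< y) × y ⊴ (x ⊔< y) × (∀ z → x ⊴ z → y ⊴ z → (x ⊔< y) ⊴ z)
  ⊔<-supremum ρ-sub p q α<β =
    inj₂ (α<β , x≤x∨y _ q) ,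
    ⊴-fibre (y≤x∨y _ q) ,
    λ z x⊴z y⊴z → ⊴-fibre-least z (⊴-raise ρ-sub z α<β x⊴z y⊴z) y⊴z

  ⊔-supremum : RhoSubadditive → Supremum _⊴_ _⊔_
  ⊔-supremum ρ-sub (α , p) (β , q) with compare α β
  ... | tri< α<β _ _ = ⊔<-supremum ρ-sub p q α<β
  ... | tri≈ _ refl _ = ⊴-fibre (x≤x∨y p q) , ⊴-fibre (y≤x∨y p q) , ⊴-fibre-least
  ... | tri> _ _ β<α = let y⊴ , x⊴ , least = ⊔<-supremum ρ-sub q p β<α in
                       x⊴ , y⊴ , λ z x⊴z y⊴z → least z y⊴z x⊴z

  ⊴-isJoinSemilattice : RhoTransitive → RhoSubadditive → IsJoinSemilattice _≋_ _⊴_ _⊔_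
  ⊴-isJoinSemilattice ρ-trans ρ-sub = record
    { isPartialOrder = ⊴-isPartialOrder ρ-trans
    ; supremum       = ⊔-supremum ρ-sub
    }

  proj₁-⊔ : ∀ x y → proj₁ (x ⊔ y) ≡ proj₁ x ⊎ proj₁ (x ⊔ y) ≡ proj₁ y
  proj₁-⊔ (α , _) (β , _) with compare α β
  ... | tri< _ _ _ = inj₂ refl
  ... | tri≈ _ _ _ = inj₁ refl
  ... | tri> _ _ _ = inj₁ refl

  proj₂-⊔ : ∀ x y → proj₁ x ≡ proj₁ y → proj₂ (x ⊔ y) ≈ (proj₂ x ∨ proj₂ y)
  proj₂-⊔ (α , _) (β , _) α≡β with compare α β
  ... | tri< _ α≢β _ = contradiction α≡β α≢β
  ... | tri≈ _ _ _   = Eq.refl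
  ... | tri> _ α≢β _ = contradiction α≡β α≢β

corollary5p5 : ∀ {a ℓ c ℓ₁ ℓ₂} (n : ℕ) → 1 ≤ n →
    (B : BoundedJoinSemilattice c ℓ₁ ℓ₂) →
    KTopFree n (BoundedJoinSemilattice._≈_ B) (BoundedJoinSemilattice._∨_ B) →
    (γ : Ordinal a ℓ) →
    (ρ : Ordinal.Carrier γ → Ordinal.Carrier γ → BoundedJoinSemilattice.Carrier B) →
    RhoOrder.RhoTransitive γ B ρ →
    RhoOrder.RhoSubadditive γ B ρ →
    Σ (Ordinal.Carrier γ × BoundedJoinSemilattice.Carrier B →
       Ordinal.Carrier γ × BoundedJoinSemilattice.Carrier B →
       Ordinal.Carrier γ × BoundedJoinSemilattice.Carrier B)
      (λ join →
        IsJoinSemilattice (RhoOrder._≋_ γ B ρ) (RhoOrder._⊴_ γ B ρ) join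
        × KTopFree (suc n) (RhoOrder._≋_ γ B ρ) join)
corollary5p5 n _ B B-free γ ρ ρ-trans ρ-sub =
  _⊔_ , ⊴-isJoinSemilattice ρ-trans ρ-sub ,
  kTopFree-suc-fibred (IsStrictTotalOrder._≟_ (Ordinal.isStrictTotalOrder γ))
    (Poset.Eq.setoid (BoundedJoinSemilattice.poset B)) (BoundedJoinSemilattice._∨_ B)
    _⊔_ proj₁-⊔ proj₂-⊔ B-free
  where open RhoJoin γ B ρ
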